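{- For every finite sequence of transitions $\sigma=t_1\cdots t_k$, the transformation graph $G_\sigma=G_{t_1}\odot\cdots\odot G_{t_k}$ reflects $\sigma$.
   Context: Clocks: $X=\{x_0,\dots,x_n\}$ with reference clock $x_0$. A (standard) valuation is $v:X\to\mathbb{R}_{\ge0}$ with $v(x_0)=0$. A transition $t$ has a guard $g$ (conjunction of atomic constraints $x\sim c$, $x\ne x_0$, $\sim\in\{<,\le,=,\ge,>\}$, $c\in\mathbb{N}$) and reset set $R\subseteq X\setminus\{x_0\}$; $v\xrightarrow{t}_{\delta}v'$ iff $v+\delta\models g$ and $v'=[R](v+\delta)$ ($v+\delta$ adds $\delta\ge0$ to all clocks except $x_0$). $v_0\xrightarrow{\sigma}_\delta v_k$ is the composition of the steps with total delay $\delta$. Transformation graph: weighted digraph on $\{0,\dots,k\}\times X$ with weights $(\preccurlyeq,d)$, $\preccurlyeq\in\{<,\le\}$, $d\in\mathbb{Z}$. Loose valuation: $v:X\to\mathbb{R}$ with $v(x_i)\ge v(x_0)$; $\mathit{norm}(v)(x)=v(x)-v(x_0)$. Solution: loose valuations $v_0,\dots,v_k$ with $v_p(x_q)-v_i(x_j)\preccurlyeq d$ for every edge $(i,x_j)\to(p,x_q)$ of weight $(\preccurlyeq,d)$. $G$ reflects $\sigma$ if (1) every solution $v_0,\dots,v_k$ gives $\mathit{norm}(v_0)\xrightarrow{\sigma}_{\delta}\mathit{norm}(v_k)$ with $\delta=v_0(x_0)-v_k(x_0)$, and (2) whenever $v_0\xrightarrow{\sigma}_\delta v_k$ there is a solution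 with first element $v_0$ and last element $v_k-\delta$. $G_t$ for $t=(g,R)$: vertices $\{0,1,2\}\times X$; edges of weight $(\le,0)$: $(0,x_0)\to(1,x_0)$; $(0,x_i)\leftrightarrow(1,x_i)$ for $x_i\ne x_0$; $(1,x_i)\leftrightarrow(2,x_i)$ for $x_i\notin R$ (including $x_0$); $(1,x_i)\to(2,x_i)$ for $x_i\in R$; $(2,x_0)\leftrightarrow(2,x_i)$ for $x_i\in R$; guard edges $(1,x_0)\to(1,x_i)$ of weight $(\preccurlyeq,c)$ for each atomic $x_i\preccurlyeq c$ in $g$ and $(1,x_i)\to(1,x_0)$ of weight $(<,-c)$ for each $x_i>c$, $(\le,-c)$ for each $x_i\ge c$ in $g$ (equality counts as both). Composition $G_1\odot G_2$ ($k_1,k_2$ columns): $k_1+k_2$ columns, edges of $G_1$ on the first $k_1$ columns, edges of $G_2$ shifted by $k_1$, plus $(\le,0)$ edges both ways between $(k_1-1,x)$ and $(k_1,x)$ for every $x$. -}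

module Defs where

open import Level using (Level) renaming (suc to lsuc)
open import Data.Bool using (Bool; true; false; if_then_else_)
open import Data.Nat as ℕ using (ℕ; zero; suc)
open import Data.Integer as ℤ using (ℤ; +_; -[1+_])
open import Data.Fin using (Fin; zero; suc; fromℕ; _↑ˡ_; _↑ʳ_)
open import Data.Fin.Subset using (Subset)
open import Data.Vec using (lookup)
open import Data.List using (List; []; _∷_; _++_; map; concatMap; allFin)
open import Data.List.Membership.Propositional using (_∈_)
open import Data.Product using (Σ; ∃; _×_; _,_)
open import Relation.Binary.Core using (Rel)
open import Relation.Binary.Structures using (IsTotalOrder)
open import Algebra.Structures using (IsAbelianGroup)
open import Relation.Binary.PropositionalEquality using (_≡_; _≢_)

-- The paper uses ℝ, which agda-stdlib lacks; we work over an
-- arbitrary linearly ordered abelian group with a positive unit 1#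
-- (ℝ is an instance).  Integer constants c are interpreted as c · 1#.

record LOAG (ℓ : Level) : Set (lsuc ℓ) where
  infixl 6 _+_
  infix 4 _≤_
  field
    Carrier        : Set ℓ
    _+_            : Carrier → Carrier → Carrier
    0#             : Carrier
    -_             : Carrier → Carrier
    1#             : Carrier
    _≤_            : Rel Carrier ℓ
    isAbelianGroup : IsAbelianGroup _≡_ _+_ 0# -_
    isTotalOrder   : IsTotalOrder _≡_ _≤_
    +-mono-≤       : ∀ z {x y} → x ≤ y → x + z ≤ y + z
    0≤1            : 0# ≤ 1#
    0≢1            : 0# ≢ 1#

-- Syntax: clocks x₀,…,xₙ are Fin (suc n), x₀ = zero, xᵢ₊₁ = suc i.

Clock : ℕ → Set
Clock n = Fin (suc n)

data Cmp : Set where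
  lt le eq ge gt : Cmp

-- atomic constraint  x_{suc i} ∼ c  (never on the reference clock)
record Atom (n : ℕ) : Set where
  constructor atom
  field
    clk   : Fin n
    op    : Cmp
    const : ℕ

-- transition t = (g, R); R ⊆ X ∖ {x₀} given as a subset of the n
-- non-reference clocks
record Transition (n : ℕ) : Set where
  constructor trans
  field
    guard : List (Atom n)
    reset : Subset n

data Ineq : Set where
  strict nonstrict : Ineq

record Edge (m n : ℕ) : Set where
  constructor edge
  field
    sc  : Fin m
    sx  : Clock n
    tc  : Fin m
    tx  : Clock n
    rel : Ineq
    wt  : ℤ

record Graph (n : ℕ) : Set where
  constructor graph
  field
    last  : ℕ
    edges : List (Edge (suc last) n)

open Graph public

private
  c0 c1 c2 : Fin 3
  c0 = zero
  c1 = suc zero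
  c2 = suc (suc zero)

  ≤0 : ∀ {m n} → Fin m → Clock n → Fin m → Clock n → Edge m n
  ≤0 a x b y = edge a x b y nonstrict (+ 0)

  guardEdges : ∀ {n} → Atom n → List (Edge 3 n)
  guardEdges (atom i lt c) = edge c1 zero c1 (suc i) strict    (+ c) ∷ []
  guardEdges (atom i le c) = edge c1 zero c1 (suc i) nonstrict (+ c) ∷ []
  guardEdges (atom i eq c) = edge c1 zero c1 (suc i) nonstrict (+ c)
                           ∷ edge c1 (suc i) c1 zero nonstrict (ℤ.- (+ c)) ∷ []
  guardEdges (atom i ge c) = edge c1 (suc i) c1 zero nonstrict (ℤ.- (+ c)) ∷ []
  guardEdges (atom i gt c) = edge c1 (suc i) c1 zero strict    (ℤ.- (+ c)) ∷ []

  clockEdges : ∀ {n} → Subset n → Fin n → List (Edge 3 n)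
  clockEdges R i =
    ≤0 c0 (suc i) c1 (suc i) ∷ ≤0 c1 (suc i) c0 (suc i) ∷
    (if lookup R i
       then ≤0 c1 (suc i) c2 (suc i) ∷ ≤0 c2 zero c2 (suc i) ∷ ≤0 c2 (suc i) c2 zero ∷ []
       else ≤0 c1 (suc i) c2 (suc i) ∷ ≤0 c2 (suc i) c1 (suc i) ∷ [])

G : ∀ {n} → Transition n → Graph n
G {n} (trans g R) = graph 2
  ( ≤0 c0 zero c1 zero ∷ ≤0 c1 zero c2 zero ∷ ≤0 c2 zero c1 zero ∷
    concatMap (clockEdges R) (allFin n) ++ concatMap guardEdges g )

_⊙_ : ∀ {n} → Graph n → Graph n → Graph n
_⊙_ {n} (graph l₁ E₁) (graph l₂ E₂) = graph (l₁ ℕ.+ suc l₂)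
  ( map liftL E₁ ++ map liftR E₂ ++ concatMap link (allFin (suc n)) )
  where
  liftL : Edge (suc l₁) n → Edge (suc l₁ ℕ.+ suc l₂) n
  liftL (edge a x b y r d) = edge (a ↑ˡ suc l₂) x (b ↑ˡ suc l₂) y r d
  liftR : Edge (suc l₂) n → Edge (suc l₁ ℕ.+ suc l₂) n
  liftR (edge a x b y r d) = edge (suc l₁ ↑ʳ a) x (suc l₁ ↑ʳ b) y r d
  link : Clock n → List (Edge (suc l₁ ℕ.+ suc l₂) n)
  link x = ≤0 (fromℕ l₁ ↑ˡ suc l₂) x (suc l₁ ↑ʳ zero) x
         ∷ ≤0 (suc l₁ ↑ʳ zero) x (fromℕ l₁ ↑ˡ suc l₂) x ∷ []

-- G_σ = G_{t₁} ⊙ ⋯ ⊙ G_{t_k} for the nonempty sequence σ = t ∷ ts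
Gσ : ∀ {n} → Transition n → List (Transition n) → Graph n
Gσ t []        = G t
Gσ t (t' ∷ ts) = G t ⊙ Gσ t' ts

module Semantics {ℓ : Level} (O : LOAG ℓ) where
  open LOAG O

  infixl 6 _-_
  _-_ : Carrier → Carrier → Carrier
  x - y = x + (- y)

  _<_ : Carrier → Carrier → Set ℓ
  x < y = x ≤ y × x ≢ y

  ⟦_⟧ℕ : ℕ → Carrier
  ⟦ zero  ⟧ℕ = 0#
  ⟦ suc n ⟧ℕ = 1# + ⟦ n ⟧ℕ

  ⟦_⟧ℤ : ℤ → Carrier
  ⟦ + n     ⟧ℤ = ⟦ n ⟧ℕ
  ⟦ -[1+ n ] ⟧ℤ = - ⟦ suc n ⟧ℕ

  Val : ℕ → Set ℓ
  Val n = Clock n → Carrier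

  IsStd : ∀ {n} → Val n → Set ℓ
  IsStd v = v zero ≡ 0# × (∀ x → 0# ≤ v x)

  IsLoose : ∀ {n} → Val n → Set ℓ
  IsLoose v = ∀ x → v zero ≤ v x

  norm : ∀ {n} → Val n → Val n
  norm v x = v x - v zero

  shift : ∀ {n} → Val n → Carrier → Val n
  shift v δ zero    = v zero
  shift v δ (suc i) = v (suc i) + δ

  doReset : ∀ {n} → Subset n → Val n → Val n
  doReset R v zero    = v zero
  doReset R v (suc i) = if lookup R i then 0# else v (suc i)

  cmpSem : Cmp → Carrier → Carrier → Set ℓ
  cmpSem lt a b = a < b
  cmpSem le a b = a ≤ b
  cmpSem eq a b = a ≡ b
  cmpSem ge a b = b ≤ a
  cmpSem gt a b = b < a

  data SatAll {n} (v : Val n) : List (Atom n) → Set ℓ where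
    []  : SatAll v []
    _∷_ : ∀ {a g} → cmpSem (Atom.op a) (v (suc (Atom.clk a))) ⟦ Atom.const a ⟧ℕ
        → SatAll v g → SatAll v (a ∷ g)

  Step : ∀ {n} → Transition n → Val n → Carrier → Val n → Set ℓ
  Step (trans g R) v δ v' =
    0# ≤ δ × SatAll (shift v δ) g × (∀ x → v' x ≡ doReset R (shift v δ) x)

  Run : ∀ {n} → List (Transition n) → Val n → Carrier → Val n → Set ℓ
  Run []      v δ v' = δ ≡ 0# × (∀ x → v' x ≡ v x)
  Run (t ∷ σ) v δ v' =
    Σ (Val _) λ w → Σ Carrier λ δ₁ → Σ Carrier λ δ₂ →
      Step t v δ₁ w × Run σ w δ₂ v' × δ ≡ δ₁ + δ₂

  ineqSem : Ineq → Carrier → Carrier → Set ℓ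
  ineqSem strict    a b = a < b
  ineqSem nonstrict a b = a ≤ b

  EdgeHolds : ∀ {m n} → (Fin m → Val n) → Edge m n → Set ℓ
  EdgeHolds v (edge a x b y r d) = ineqSem r (v b y - v a x) ⟦ d ⟧ℤ

  Solution : ∀ {n} (Γ : Graph n) → (Fin (suc (last Γ)) → Val n) → Set ℓ
  Solution Γ v = (∀ i → IsLoose (v i)) × (∀ e → e ∈ edges Γ → EdgeHolds v e)

  Reflects : ∀ {n} → List (Transition n) → Graph n → Set ℓ
  Reflects σ Γ =
    (∀ v → Solution Γ v →
       Run σ (norm (v zero)) (v zero zero - v (fromℕ (last Γ)) zero)
             (norm (v (fromℕ (last Γ)))))
    ×
    (∀ v₀ δ vₖ → IsStd v₀ → Run σ v₀ δ vₖ →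
       Σ (Fin (suc (last Γ)) → Val _) λ v → Solution Γ v
         × (∀ x → v zero x ≡ v₀ x)
         × (∀ x → v (fromℕ (last Γ)) x ≡ vₖ x - δ))

-- A solution of G_t assigns a valuation to each phase of the step: column 0
-- before the delay, column 1 after it, column 2 after the reset.  A loose column
-- can record the delay δ as a drop of the reference clock by δ instead of a rise
-- of every other clock, so delay, guard and reset all become difference
-- constraints: the guard edges state the guard on column 1, and the reset edges
-- make each reset clock meet x₀ in column 2.  Composition glues the last column
-- of one graph to the first column of the next; for a run, the second part's
-- solution is shifted down by the delay of the first part, which preserves
-- every difference constraint.

module Submission where

open import Level using (Level)
open import Data.Bool using (Bool; true; false; if_then_else_)
open import Data.Nat as ℕ using (ℕ; zero; suc)
import Data.Integer as ℤ
open import Data.Fin using (Fin; zero; suc; fromℕ; _↑ˡ_; _↑ʳ_; splitAt)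
open import Data.Fin.Properties using (splitAt-↑ˡ; splitAt-↑ʳ)
open import Data.Fin.Subset using (Subset)
open import Data.Vec using (lookup)
open import Data.List using (List; []; _∷_; _++_; concatMap; allFin)
open import Data.List.Relation.Unary.All as All using (All; []; _∷_)
open import Data.List.Relation.Unary.All.Properties
  using (++⁺; ++⁻; map⁺; map⁻; concat⁺; concat⁻; tabulate⁺; tabulate⁻)
open import Data.Product using (Σ; _×_; _,_; proj₁; proj₂)
open import Data.Sum using ([_,_]; [_,_]′)
open import Function using (_∘_; id)
open import Function.Bundles using (_⇔_; mk⇔; module Equivalence)
open import Relation.Binary.PropositionalEquality
  using (_≡_; refl; sym; cong; cong₂; subst; subst₂; module ≡-Reasoning)
  renaming (trans to ≡-trans)
open import Relation.Binary.Structures using (IsTotalOrder)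
open import Algebra.Bundles using (AbelianGroup)
import Algebra.Properties.AbelianGroup as AbelianGroupProperties
open import Defs

open Equivalence using (to; from)

module _ {a b p} {A : Set a} {B : Set b} {P : B → Set p} where

  All-concatMap⁺ : ∀ {f : A → List B} {xs} → All (All P ∘ f) xs → All P (concatMap f xs)
  All-concatMap⁺ = concat⁺ ∘ map⁺

  All-concatMap⁻ : ∀ {f : A → List B} xs → All P (concatMap f xs) → All (All P ∘ f) xs
  All-concatMap⁻ xs = map⁻ ∘ concat⁻

fromℕ-+ : ∀ m n → fromℕ (m ℕ.+ suc n) ≡ suc m ↑ʳ fromℕ n
fromℕ-+ zero    n = refl
fromℕ-+ (suc m) n = cong suc (fromℕ-+ m n)

c₀ c₁ c₂ : Fin 3
c₀ = zero
c₁ = suc zero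
c₂ = suc (suc zero)

tight : ∀ {m n} → Fin m → Clock n → Fin m → Clock n → Edge m n
tight a x b y = edge a x b y nonstrict (ℤ.+ 0)

referenceEdges : ∀ {n} → List (Edge 3 n)
referenceEdges = tight c₀ zero c₁ zero ∷ tight c₁ zero c₂ zero ∷ tight c₂ zero c₁ zero ∷ []

clockEdges : ∀ {n} → Fin n → Bool → List (Edge 3 n)
clockEdges i reset =
  tight c₀ (suc i) c₁ (suc i) ∷ tight c₁ (suc i) c₀ (suc i) ∷
  (if reset
     then tight c₁ (suc i) c₂ (suc i) ∷ tight c₂ zero c₂ (suc i) ∷ tight c₂ (suc i) c₂ zero ∷ []
     else tight c₁ (suc i) c₂ (suc i) ∷ tight c₂ (suc i) c₁ (suc i) ∷ [])

-- Defs keeps the edge list of a guard atom private; unification against G recovers it.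
G-edges : ∀ {n} → Σ (Atom n → List (Edge 3 n)) λ guardEdges → ∀ g R →
  edges (G (trans g R)) ≡
    referenceEdges ++ concatMap (λ i → clockEdges i (lookup R i)) (allFin n) ++ concatMap guardEdges g
G-edges = _ , λ g R → refl

guardEdges : ∀ {n} → Atom n → List (Edge 3 n)
guardEdges = proj₁ G-edges

module _ {ℓ : Level} (O : LOAG ℓ) where
  open LOAG O
  open Semantics O

  abelianGroup : AbelianGroup ℓ ℓ
  abelianGroup = record { isAbelianGroup = isAbelianGroup }

  open AbelianGroup abelianGroup using (assoc; comm; identityˡ; identityʳ; inverseʳ)
  open AbelianGroupProperties abelianGroup
    using (ε⁻¹≈ε; ⁻¹-involutive; ⁻¹-injective; ⁻¹-anti-homo‿-; ⁻¹-∙-comm;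
           \\-leftDividesˡ; \\-leftDividesʳ; //-rightDividesˡ; //-rightDividesʳ; x≈y⇒x∙y⁻¹≈ε)
  open IsTotalOrder isTotalOrder using (antisym)
    renaming (refl to ≤-refl; trans to ≤-trans; reflexive to ≤-reflexive)
  open ≡-Reasoning

  telescope : ∀ x y z → (x - y) + (y - z) ≡ x - z
  telescope x y z = begin
    (x - y) + (y - z)   ≡⟨ assoc x (- y) (y - z) ⟩
    x + (- y + (y - z)) ≡⟨ cong (x +_) (\\-leftDividesʳ y (- z)) ⟩
    x - z               ∎

  -‿-shift : ∀ x y d → (x - d) - (y - d) ≡ x - y
  -‿-shift x y d = begin
    (x - d) - (y - d) ≡⟨ cong ((x - d) +_) (⁻¹-anti-homo‿- y d) ⟩
    (x - d) + (d - y) ≡⟨ telescope x d y ⟩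
    x - y             ∎

  -‿-‿+ : ∀ x a b → x - a - b ≡ x - (b + a)
  -‿-‿+ x a b = begin
    x - a - b       ≡⟨ assoc x (- a) (- b) ⟩
    x + (- a + - b) ≡⟨ cong (x +_) (⁻¹-∙-comm a b) ⟩
    x - (a + b)     ≡⟨ cong (λ z → x - z) (comm a b) ⟩
    x - (b + a)     ∎

  ⟦-⟧ℤ : ∀ c → ⟦ ℤ.- (ℤ.+ c) ⟧ℤ ≡ - ⟦ c ⟧ℕ
  ⟦-⟧ℤ zero    = sym ε⁻¹≈ε
  ⟦-⟧ℤ (suc c) = refl

  x≤y⇒x-y≤0 : ∀ {x y} → x ≤ y → x - y ≤ 0#
  x≤y⇒x-y≤0 {x} {y} h = subst (x - y ≤_) (inverseʳ y) (+-mono-≤ (- y) h)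

  x-y≤0⇒x≤y : ∀ {x y} → x - y ≤ 0# → x ≤ y
  x-y≤0⇒x≤y {x} {y} h = subst₂ _≤_ (//-rightDividesˡ y x) (identityˡ y) (+-mono-≤ y h)

  y≤x⇒0≤x-y : ∀ {x y} → y ≤ x → 0# ≤ x - y
  y≤x⇒0≤x-y {x} {y} h = subst (_≤ x - y) (inverseʳ y) (+-mono-≤ (- y) h)

  x≡y⇒x-y≤0 : ∀ {x y} → x ≡ y → x - y ≤ 0#
  x≡y⇒x-y≤0 = ≤-reflexive ∘ x≈y⇒x∙y⁻¹≈ε

  -≤0-antisym : ∀ {x y} → x - y ≤ 0# → y - x ≤ 0# → x ≡ y
  -≤0-antisym p q = antisym (x-y≤0⇒x≤y p) (x-y≤0⇒x≤y q)

  neg-mono-≤ : ∀ {x y} → x ≤ y → - y ≤ - x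
  neg-mono-≤ {x} {y} h = subst₂ _≤_ (\\-leftDividesˡ x (- y)) y-cancels (+-mono-≤ (- x + - y) h)
    where
    y-cancels : y + (- x + - y) ≡ - x
    y-cancels = ≡-trans (cong (y +_) (comm (- x) (- y))) (\\-leftDividesˡ y (- x))

  neg-cancel-≤ : ∀ {x y} → - y ≤ - x → x ≤ y
  neg-cancel-≤ h = subst₂ _≤_ (⁻¹-involutive _) (⁻¹-involutive _) (neg-mono-≤ h)

  0≤x⇒-x≤0 : ∀ {x} → 0# ≤ x → - x ≤ 0#
  0≤x⇒-x≤0 h = subst (_ ≤_) ε⁻¹≈ε (neg-mono-≤ h)

  0≤x+y : ∀ {x y} → 0# ≤ x → 0# ≤ y → 0# ≤ x + y
  0≤x+y {x} {y} hx hy = ≤-trans hy (subst (_≤ x + y) (identityˡ y) (+-mono-≤ y hx))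

  -- An edge (1,xᵢ) → (1,x₀) of weight -c is the lower bound c on xᵢ.
  lower-bound-≤ : ∀ x y c → (y - x ≤ ⟦ ℤ.- (ℤ.+ c) ⟧ℤ) ⇔ (⟦ c ⟧ℕ ≤ x - y)
  lower-bound-≤ x y c = mk⇔
    (λ h → neg-cancel-≤ (subst₂ _≤_ (sym (⁻¹-anti-homo‿- x y)) (⟦-⟧ℤ c) h))
    (λ h → subst₂ _≤_ (⁻¹-anti-homo‿- x y) (sym (⟦-⟧ℤ c)) (neg-mono-≤ h))

  lower-bound-≡ : ∀ x y c → (y - x ≡ ⟦ ℤ.- (ℤ.+ c) ⟧ℤ) ⇔ (⟦ c ⟧ℕ ≡ x - y)
  lower-bound-≡ x y c = mk⇔
    (λ h → sym (⁻¹-injective (≡-trans (⁻¹-anti-homo‿- x y) (≡-trans h (⟦-⟧ℤ c)))))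
    (λ h → ≡-trans (sym (⁻¹-anti-homo‿- x y)) (≡-trans (cong -_ (sym h)) (sym (⟦-⟧ℤ c))))

  lower-bound-< : ∀ x y c → ((y - x) < ⟦ ℤ.- (ℤ.+ c) ⟧ℤ) ⇔ (⟦ c ⟧ℕ < (x - y))
  lower-bound-< x y c = mk⇔
    (λ (h , h≢) → to (lower-bound-≤ x y c) h , h≢ ∘ from (lower-bound-≡ x y c))
    (λ (h , h≢) → from (lower-bound-≤ x y c) h , h≢ ∘ to (lower-bound-≡ x y c))

  Columns : ∀ {n} → Graph n → Set ℓ
  Columns {n} Γ = Fin (suc (last Γ)) → Val n

  EdgesHold : ∀ {n} (Γ : Graph n) → Columns Γ → Set ℓ
  EdgesHold Γ v = All (EdgeHolds v) (edges Γ)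

  edgesHold : ∀ {n} {Γ : Graph n} {v} → Solution Γ v → EdgesHold Γ v
  edgesHold (_ , holds) = All.tabulate (holds _)

  mkSolution : ∀ {n} {Γ : Graph n} {v} → (∀ c → IsLoose (v c)) → EdgesHold Γ v → Solution Γ v
  mkSolution loose h = loose , λ _ → All.lookup h

  EdgeHolds-resp : ∀ {m n} {v w : Fin m → Val n} → (∀ c → v c ≡ w c) →
                   ∀ {e} → EdgeHolds w e → EdgeHolds v e
  EdgeHolds-resp v≡w {edge a x b y r d} h rewrite v≡w a | v≡w b = h

  Solution-shift : ∀ {n} {Γ : Graph n} {v} δ → Solution Γ v → Solution Γ (λ c x → v c x - δ)
  Solution-shift {v = v} δ (loose , holds) =
    (λ c x → +-mono-≤ (- δ) (loose c x)) , λ e e∈ → shifted e (holds e e∈)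
    where
    shifted : ∀ e → EdgeHolds v e → EdgeHolds (λ c x → v c x - δ) e
    shifted (edge a x b y r d) =
      subst (λ z → ineqSem r z ⟦ d ⟧ℤ) (sym (-‿-shift (v b y) (v a x) δ))

  module Composition {n} (Γ₁ Γ₂ : Graph n) where

    leftPart : Columns (Γ₁ ⊙ Γ₂) → Columns Γ₁
    leftPart v c = v (c ↑ˡ suc (last Γ₂))

    rightPart : Columns (Γ₁ ⊙ Γ₂) → Columns Γ₂
    rightPart v j = v (suc (last Γ₁) ↑ʳ j)

    glue : Columns Γ₁ → Columns Γ₂ → Columns (Γ₁ ⊙ Γ₂)
    glue u s c = [ u , s ]′ (splitAt (suc (last Γ₁)) c)

    linkEdges : Clock n → List (Edge (suc (last (Γ₁ ⊙ Γ₂))) n)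
    linkEdges x = tight (fromℕ (last Γ₁) ↑ˡ suc (last Γ₂)) x (suc (last Γ₁) ↑ʳ zero) x
                ∷ tight (suc (last Γ₁) ↑ʳ zero) x (fromℕ (last Γ₁) ↑ˡ suc (last Γ₂)) x ∷ []

    glue-↑ˡ : ∀ u s c → glue u s (c ↑ˡ suc (last Γ₂)) ≡ u c
    glue-↑ˡ u s c = cong [ u , s ]′ (splitAt-↑ˡ (suc (last Γ₁)) c (suc (last Γ₂)))

    glue-↑ʳ : ∀ u s j → glue u s (suc (last Γ₁) ↑ʳ j) ≡ s j
    glue-↑ʳ u s j = cong [ u , s ]′ (splitAt-↑ʳ (suc (last Γ₁)) (suc (last Γ₂)) j)

    glue-∀ : ∀ {P : Val n → Set ℓ} {u s} → (∀ c → P (u c)) → (∀ j → P (s j)) →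
             ∀ c → P (glue u s c)
    glue-∀ {P} {u} {s} Pu Ps c =
      [_,_] {C = λ z → P ([ u , s ]′ z)} Pu Ps (splitAt (suc (last Γ₁)) c)

    ⊙-holds⁻ : ∀ {v} → EdgesHold (Γ₁ ⊙ Γ₂) v →
               EdgesHold Γ₁ (leftPart v) × EdgesHold Γ₂ (rightPart v) ×
               (∀ x → leftPart v (fromℕ (last Γ₁)) x ≡ rightPart v zero x)
    ⊙-holds⁻ h =
      let h₁ , h′ = ++⁻ _ h
          h₂ , hₗ = ++⁻ _ h′
          hₗ′ = tabulate⁻ {f = id} (All-concatMap⁻ {f = linkEdges} _ hₗ)
      in map⁻ h₁ , map⁻ h₂ , λ x → linked (hₗ′ x)
      where
      linked : ∀ {v x} → All (EdgeHolds v) (linkEdges x) →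
               v (fromℕ (last Γ₁) ↑ˡ suc (last Γ₂)) x ≡ v (suc (last Γ₁) ↑ʳ zero) x
      linked (p ∷ q ∷ []) = -≤0-antisym q p

    ⊙-holds⁺ : ∀ {u s} → EdgesHold Γ₁ u → EdgesHold Γ₂ s →
               (∀ x → u (fromℕ (last Γ₁)) x ≡ s zero x) → EdgesHold (Γ₁ ⊙ Γ₂) (glue u s)
    ⊙-holds⁺ {u} {s} h₁ h₂ link =
      ++⁺ (map⁺ (All.map (λ {e} → EdgeHolds-resp (glue-↑ˡ u s) {e}) h₁))
          (++⁺ (map⁺ (All.map (λ {e} → EdgeHolds-resp (glue-↑ʳ u s) {e}) h₂))
               (All-concatMap⁺ {f = linkEdges} (tabulate⁺ {f = id} linked)))
      where
      glued : ∀ x → glue u s (fromℕ (last Γ₁) ↑ˡ suc (last Γ₂)) x ≡ glue u s (suc (last Γ₁) ↑ʳ zero) x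
      glued x = begin
        glue u s (fromℕ (last Γ₁) ↑ˡ suc (last Γ₂)) x ≡⟨ cong (λ f → f x) (glue-↑ˡ u s _) ⟩
        u (fromℕ (last Γ₁)) x                         ≡⟨ link x ⟩
        s zero x                                      ≡⟨ cong (λ f → f x) (glue-↑ʳ u s zero) ⟨
        glue u s (suc (last Γ₁) ↑ʳ zero) x            ∎
      linked : ∀ x → All (EdgeHolds (glue u s)) (linkEdges x)
      linked x = x≡y⇒x-y≤0 (sym (glued x)) ∷ x≡y⇒x-y≤0 (glued x) ∷ []

  Step-resp : ∀ {n} (t : Transition n) {v δ w w′} → (∀ x → w′ x ≡ w x) → Step t v δ w → Step t v δ w′
  Step-resp (trans g R) w′≡w (δ≥0 , sat , reset) = δ≥0 , sat , λ x → ≡-trans (w′≡w x) (reset x)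

  Step-std : ∀ {n} (t : Transition n) {v δ w} → IsStd v → Step t v δ w → IsStd w
  Step-std (trans g R) {v} {δ} {w} (v₀≡0 , v≥0) (δ≥0 , _ , reset) = w₀≡0 , w≥0
    where
    w₀≡0 : w zero ≡ 0#
    w₀≡0 = ≡-trans (reset zero) v₀≡0
    reset-nonneg : ∀ i b → 0# ≤ (if b then 0# else v (suc i) + δ)
    reset-nonneg i true  = ≤-refl
    reset-nonneg i false = 0≤x+y (v≥0 (suc i)) δ≥0
    w≥0 : ∀ x → 0# ≤ w x
    w≥0 zero    = ≤-reflexive (sym w₀≡0)
    w≥0 (suc i) = subst (0# ≤_) (sym (reset (suc i))) (reset-nonneg i (lookup R i))

  Run-std : ∀ {n} (σ : List (Transition n)) {v δ w} → IsStd v → Run σ v δ w → IsStd w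
  Run-std []      (v₀≡0 , v≥0) (_ , w≡v) =
    ≡-trans (w≡v zero) v₀≡0 , λ x → subst (0# ≤_) (sym (w≡v x)) (v≥0 x)
  Run-std (t ∷ σ) std (_ , _ , _ , step , run , _) = Run-std σ (Step-std t std step) run

  Step⇒Run : ∀ {n} {t : Transition n} {v δ w} → Step t v δ w → Run (t ∷ []) v δ w
  Step⇒Run {δ = δ} {w} step = w , δ , 0# , step , (refl , λ _ → refl) , sym (identityʳ δ)

  Run⇒Step : ∀ {n} (t : Transition n) {v δ w} → Run (t ∷ []) v δ w → Step t v δ w
  Run⇒Step t (_ , δ₁ , _ , step , (δ₂≡0 , w≡w′) , δ≡) =
    subst (λ d → Step t _ d _) (sym δ≡δ₁) (Step-resp t w≡w′ step)
    where
    δ≡δ₁ = ≡-trans δ≡ (≡-trans (cong (δ₁ +_) δ₂≡0) (identityʳ δ₁))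

  Run-++⁺ : ∀ {n} (t : Transition n) σ₁ σ₂ {u w w′ u′ δ₁ δ₂} →
            Run (t ∷ σ₁) u δ₁ w → (∀ x → w′ x ≡ w x) → Run σ₂ w′ δ₂ u′ →
            Run (t ∷ σ₁ ++ σ₂) u (δ₁ + δ₂) u′
  Run-++⁺ t [] σ₂ {w′ = w′} {δ₂ = δ₂} (_ , δ′ , δ″ , step , (δ″≡0 , w≡w₁) , δ₁≡) w′≡w run₂ =
    w′ , δ′ , δ₂ , Step-resp t (λ x → ≡-trans (w′≡w x) (w≡w₁ x)) step , run₂ ,
    cong (_+ δ₂) (≡-trans δ₁≡ (≡-trans (cong (δ′ +_) δ″≡0) (identityʳ δ′)))
  Run-++⁺ t (t′ ∷ σ₁) σ₂ {δ₂ = δ₂} (w₁ , δ′ , δ″ , step , run₁ , δ₁≡) w′≡w run₂ =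
    w₁ , δ′ , δ″ + δ₂ , step , Run-++⁺ t′ σ₁ σ₂ run₁ w′≡w run₂ ,
    ≡-trans (cong (_+ δ₂) δ₁≡) (assoc δ′ δ″ δ₂)

  Run-++⁻ : ∀ {n} (σ₁ σ₂ : List (Transition n)) {u δ u′} → Run (σ₁ ++ σ₂) u δ u′ →
            Σ (Val n) λ w → Σ Carrier λ δ₁ → Σ Carrier λ δ₂ →
              Run σ₁ u δ₁ w × Run σ₂ w δ₂ u′ × δ ≡ δ₁ + δ₂
  Run-++⁻ [] σ₂ {u} run = u , 0# , _ , (refl , λ _ → refl) , run , sym (identityˡ _)
  Run-++⁻ (t ∷ σ₁) σ₂ (w₁ , δ′ , δ″ , step , run , δ≡) =
    let w , δ₁ , δ₂ , run₁ , run₂ , δ″≡ = Run-++⁻ σ₁ σ₂ run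
    in w , δ′ + δ₁ , δ₂ , (w₁ , δ′ , δ₁ , step , run₁ , refl) , run₂ ,
       ≡-trans δ≡ (≡-trans (cong (δ′ +_) δ″≡) (sym (assoc δ′ δ₁ δ₂)))

  G-holds⁻ : ∀ {n} g (R : Subset n) {u} → EdgesHold (G (trans g R)) u →
             All (EdgeHolds u) referenceEdges ×
             (∀ i → All (EdgeHolds u) (clockEdges i (lookup R i))) ×
             All (All (EdgeHolds u) ∘ guardEdges) g
  G-holds⁻ {n} g R h =
    let reference , h′ = ++⁻ referenceEdges h
        clocks , guards = ++⁻ (concatMap (λ i → clockEdges i (lookup R i)) (allFin n)) h′
    in reference , tabulate⁻ {f = id} (All-concatMap⁻ (allFin n) clocks) , All-concatMap⁻ g guards

  G-holds⁺ : ∀ {n} g (R : Subset n) {u} →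
             All (EdgeHolds u) referenceEdges →
             (∀ i → All (EdgeHolds u) (clockEdges i (lookup R i))) →
             All (All (EdgeHolds u) ∘ guardEdges) g → EdgesHold (G (trans g R)) u
  G-holds⁺ g R reference clocks guards =
    ++⁺ reference (++⁺ (All-concatMap⁺ (tabulate⁺ {f = id} clocks)) (All-concatMap⁺ guards))

  AtomHolds : ∀ {n} → Val n → Atom n → Set ℓ
  AtomHolds v a = cmpSem (Atom.op a) (v (suc (Atom.clk a))) ⟦ Atom.const a ⟧ℕ

  AtomHolds-resp : ∀ {n} {v w : Val n} → (∀ i → v (suc i) ≡ w (suc i)) →
                   ∀ {a} → AtomHolds v a → AtomHolds w a
  AtomHolds-resp v≡w {atom i op c} = subst (λ z → cmpSem op z ⟦ c ⟧ℕ) (v≡w i)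

  SatAll⇒All : ∀ {n} {v : Val n} {g} → SatAll v g → All (AtomHolds v) g
  SatAll⇒All []       = []
  SatAll⇒All (p ∷ ps) = p ∷ SatAll⇒All ps

  All⇒SatAll : ∀ {n} {v : Val n} {g} → All (AtomHolds v) g → SatAll v g
  All⇒SatAll []       = []
  All⇒SatAll (p ∷ ps) = p ∷ All⇒SatAll ps

  guardEdges-holds⁻ : ∀ {n} {u : Fin 3 → Val n} a →
                      All (EdgeHolds u) (guardEdges a) → AtomHolds (norm (u c₁)) a
  guardEdges-holds⁻ (atom i lt c) (p ∷ [])     = p
  guardEdges-holds⁻ (atom i le c) (p ∷ [])     = p
  guardEdges-holds⁻ (atom i eq c) (p ∷ q ∷ []) = antisym p (to (lower-bound-≤ _ _ c) q)
  guardEdges-holds⁻ (atom i ge c) (p ∷ [])     = to (lower-bound-≤ _ _ c) p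
  guardEdges-holds⁻ (atom i gt c) (p ∷ [])     = to (lower-bound-< _ _ c) p

  guardEdges-holds⁺ : ∀ {n} {u : Fin 3 → Val n} a →
                      AtomHolds (norm (u c₁)) a → All (EdgeHolds u) (guardEdges a)
  guardEdges-holds⁺ (atom i lt c) h = h ∷ []
  guardEdges-holds⁺ (atom i le c) h = h ∷ []
  guardEdges-holds⁺ (atom i eq c) h =
    ≤-reflexive h ∷ from (lower-bound-≤ _ _ c) (≤-reflexive (sym h)) ∷ []
  guardEdges-holds⁺ (atom i ge c) h = from (lower-bound-≤ _ _ c) h ∷ []
  guardEdges-holds⁺ (atom i gt c) h = from (lower-bound-< _ _ c) h ∷ []

  G-sound : ∀ {n} (t : Transition n) {u : Fin 3 → Val n} → EdgesHold (G t) u →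
            Step t (norm (u c₀)) (u c₀ zero - u c₂ zero) (norm (u c₂))
  G-sound (trans g R) {u} h with G-holds⁻ g R h
  ... | d ∷ p ∷ q ∷ [] , clocks , guards =
    y≤x⇒0≤x-y (subst (_≤ u c₀ zero) u₁₀≡u₂₀ (x-y≤0⇒x≤y d)) ,
    All⇒SatAll (All.map (λ {a} → guard-holds {a}) guards) ,
    after-reset
    where
    δ = u c₀ zero - u c₂ zero
    u₁₀≡u₂₀ : u c₁ zero ≡ u c₂ zero
    u₁₀≡u₂₀ = -≤0-antisym q p
    u₀ᵢ≡u₁ᵢ : ∀ i → u c₀ (suc i) ≡ u c₁ (suc i)
    u₀ᵢ≡u₁ᵢ i with clocks i
    ... | p ∷ q ∷ _ = -≤0-antisym q p
    after-delay : ∀ i → norm (u c₁) (suc i) ≡ shift (norm (u c₀)) δ (suc i)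
    after-delay i = sym (begin
      (u c₀ (suc i) - u c₀ zero) + (u c₀ zero - u c₂ zero) ≡⟨ telescope _ _ _ ⟩
      u c₀ (suc i) - u c₂ zero ≡⟨ cong₂ _-_ (u₀ᵢ≡u₁ᵢ i) (sym u₁₀≡u₂₀) ⟩
      u c₁ (suc i) - u c₁ zero ∎)
    guard-holds : ∀ {a} → All (EdgeHolds u) (guardEdges a) → AtomHolds (shift (norm (u c₀)) δ) a
    guard-holds {a} =
      AtomHolds-resp {v = norm (u c₁)} {w = shift (norm (u c₀)) δ} after-delay {a} ∘ guardEdges-holds⁻ a
    reset-clock : ∀ i b → All (EdgeHolds u) (clockEdges i b) →
                  norm (u c₂) (suc i) ≡ (if b then 0# else shift (norm (u c₀)) δ (suc i))
    reset-clock i true  (_ ∷ _ ∷ _ ∷ p ∷ q ∷ []) = x≈y⇒x∙y⁻¹≈ε (-≤0-antisym p q)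
    reset-clock i false (_ ∷ _ ∷ p ∷ q ∷ []) =
      ≡-trans (cong₂ _-_ (-≤0-antisym p q) (sym u₁₀≡u₂₀)) (after-delay i)
    after-reset : ∀ x → norm (u c₂) x ≡ doReset R (shift (norm (u c₀)) δ) x
    after-reset zero    = ≡-trans (inverseʳ _) (sym (inverseʳ _))
    after-reset (suc i) = reset-clock i (lookup R i) (clocks i)

  -- Column 1 is v + δ, recorded loosely by lowering the reference clock to -δ.
  stepColumns : ∀ {n} → Val n → Carrier → Val n → Fin 3 → Val n
  stepColumns v δ w zero             x       = v x
  stepColumns v δ w (suc zero)       zero    = - δ
  stepColumns v δ w (suc zero)       (suc i) = v (suc i)
  stepColumns v δ w (suc (suc zero)) x       = w x - δ

  G-complete : ∀ {n} (t : Transition n) {v δ w} → IsStd v → Step t v δ w →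
               Solution (G t) (stepColumns v δ w)
  G-complete (trans g R) {v} {δ} {w} std@(v₀≡0 , v≥0) step@(δ≥0 , sat , reset) =
    mkSolution loose (G-holds⁺ g R reference clocks guards)
    where
    u = stepColumns v δ w
    w-std : IsStd w
    w-std = Step-std (trans g R) std step
    -δ≤v : ∀ x → - δ ≤ v x
    -δ≤v x = ≤-trans (0≤x⇒-x≤0 δ≥0) (v≥0 x)
    u₂₀≡u₁₀ : w zero - δ ≡ - δ
    u₂₀≡u₁₀ = ≡-trans (cong (_- δ) (proj₁ w-std)) (identityˡ (- δ))
    loose : ∀ c → IsLoose (u c)
    loose zero             x       = subst (_≤ v x) (sym v₀≡0) (v≥0 x)
    loose (suc zero)       zero    = ≤-refl
    loose (suc zero)       (suc i) = -δ≤v (suc i)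
    loose (suc (suc zero)) x       =
      +-mono-≤ (- δ) (subst (_≤ w x) (sym (proj₁ w-std)) (proj₂ w-std x))
    reference : All (EdgeHolds u) referenceEdges
    reference = x≤y⇒x-y≤0 (-δ≤v zero) ∷ x≡y⇒x-y≤0 u₂₀≡u₁₀ ∷ x≡y⇒x-y≤0 (sym u₂₀≡u₁₀) ∷ []
    clock : ∀ i b → w (suc i) ≡ (if b then 0# else v (suc i) + δ) → All (EdgeHolds u) (clockEdges i b)
    clock i true wᵢ≡0 =
      x≡y⇒x-y≤0 refl ∷ x≡y⇒x-y≤0 refl ∷
      x≤y⇒x-y≤0 (subst (_≤ v (suc i)) (sym u₂ᵢ≡-δ) (-δ≤v (suc i))) ∷
      x≡y⇒x-y≤0 (≡-trans u₂ᵢ≡-δ (sym u₂₀≡u₁₀)) ∷ x≡y⇒x-y≤0 (≡-trans u₂₀≡u₁₀ (sym u₂ᵢ≡-δ)) ∷ []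
      where
      u₂ᵢ≡-δ : w (suc i) - δ ≡ - δ
      u₂ᵢ≡-δ = ≡-trans (cong (_- δ) wᵢ≡0) (identityˡ (- δ))
    clock i false wᵢ≡vᵢ+δ =
      x≡y⇒x-y≤0 refl ∷ x≡y⇒x-y≤0 refl ∷ x≡y⇒x-y≤0 u₂ᵢ≡vᵢ ∷ x≡y⇒x-y≤0 (sym u₂ᵢ≡vᵢ) ∷ []
      where
      u₂ᵢ≡vᵢ : w (suc i) - δ ≡ v (suc i)
      u₂ᵢ≡vᵢ = ≡-trans (cong (_- δ) wᵢ≡vᵢ+δ) (//-rightDividesʳ δ (v (suc i)))
    clocks : ∀ i → All (EdgeHolds u) (clockEdges i (lookup R i))
    clocks i = clock i (lookup R i) (reset (suc i))
    after-delay : ∀ i → shift v δ (suc i) ≡ norm (u c₁) (suc i)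
    after-delay i = cong (v (suc i) +_) (sym (⁻¹-involutive δ))
    guards : All (All (EdgeHolds u) ∘ guardEdges) g
    guards = All.map (λ {a} → guard-holds {a}) (SatAll⇒All sat)
      where
      guard-holds : ∀ {a} → AtomHolds (shift v δ) a → All (EdgeHolds u) (guardEdges a)
      guard-holds {a} =
        guardEdges-holds⁺ a ∘ AtomHolds-resp {v = shift v δ} {w = norm (u c₁)} after-delay {a}

  G-reflects : ∀ {n} (t : Transition n) → Reflects (t ∷ []) (G t)
  G-reflects t =
    (λ u sol → Step⇒Run (G-sound t (edgesHold sol))) ,
    (λ v δ w std run → stepColumns v δ w , G-complete t std (Run⇒Step t run) ,
                       (λ _ → refl) , (λ _ → refl))

  ⊙-reflects : ∀ {n} {t : Transition n} {σ₁ σ₂} {Γ₁ Γ₂ : Graph n} →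
               Reflects (t ∷ σ₁) Γ₁ → Reflects σ₂ Γ₂ → Reflects (t ∷ σ₁ ++ σ₂) (Γ₁ ⊙ Γ₂)
  ⊙-reflects {n} {t} {σ₁} {σ₂} {Γ₁} {Γ₂} (sound₁ , complete₁) (sound₂ , complete₂) = sound , complete
    where
    open Composition Γ₁ Γ₂

    sound : ∀ v → Solution (Γ₁ ⊙ Γ₂) v →
            Run (t ∷ σ₁ ++ σ₂) (norm (v zero)) (v zero zero - v (fromℕ (last (Γ₁ ⊙ Γ₂))) zero)
                (norm (v (fromℕ (last (Γ₁ ⊙ Γ₂)))))
    sound v sol@(loose , _) with ⊙-holds⁻ (edgesHold sol)
    ... | h₁ , h₂ , link rewrite fromℕ-+ (last Γ₁) (last Γ₂) =
      subst (λ δ → Run (t ∷ σ₁ ++ σ₂) (norm (v zero)) δ (norm (rightPart v (fromℕ (last Γ₂)))))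
            delays
        (Run-++⁺ t σ₁ σ₂ (sound₁ (leftPart v) (mkSolution (λ _ → loose _) h₁))
                         (λ x → cong₂ _-_ (sym (link x)) (sym (link zero)))
                         (sound₂ (rightPart v) (mkSolution (λ _ → loose _) h₂)))
      where
      m = leftPart v (fromℕ (last Γ₁)) zero
      end = rightPart v (fromℕ (last Γ₂)) zero
      delays : (v zero zero - m) + (rightPart v zero zero - end) ≡ v zero zero - end
      delays = ≡-trans (cong (λ z → (v zero zero - m) + (z - end)) (sym (link zero)))
                       (telescope _ _ _)

    complete : ∀ v₀ δ vₖ → IsStd v₀ → Run (t ∷ σ₁ ++ σ₂) v₀ δ vₖ →
               Σ (Columns (Γ₁ ⊙ Γ₂)) λ v → Solution (Γ₁ ⊙ Γ₂) v ×
                 (∀ x → v zero x ≡ v₀ x) × (∀ x → v (fromℕ (last (Γ₁ ⊙ Γ₂))) x ≡ vₖ x - δ)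
    complete v₀ δ vₖ std run with Run-++⁻ (t ∷ σ₁) σ₂ run
    ... | w , δ₁ , δ₂ , run₁ , run₂ , δ≡
        with complete₁ v₀ δ₁ w std run₁ | complete₂ w δ₂ vₖ (Run-std (t ∷ σ₁) std run₁) run₂
    ... | u , sol₁ , u-first , u-last | s , sol₂ , s-first , s-last =
      glue u s′ , mkSolution (glue-∀ {P = IsLoose} (proj₁ sol₁) (proj₁ sol₂′)) holds ,
      u-first , last-column
      where
      s′ : Columns Γ₂
      s′ j x = s j x - δ₁
      sol₂′ = Solution-shift δ₁ sol₂
      holds = ⊙-holds⁺ (edgesHold sol₁) (edgesHold sol₂′)
                (λ x → ≡-trans (u-last x) (cong (_- δ₁) (sym (s-first x))))
      last-column : ∀ x → glue u s′ (fromℕ (last Γ₁ ℕ.+ suc (last Γ₂))) x ≡ vₖ x - δ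
      last-column x = begin
        glue u s′ (fromℕ (last Γ₁ ℕ.+ suc (last Γ₂))) x
          ≡⟨ cong (λ c → glue u s′ c x) (fromℕ-+ (last Γ₁) (last Γ₂)) ⟩
        glue u s′ (suc (last Γ₁) ↑ʳ fromℕ (last Γ₂)) x
          ≡⟨ cong (λ f → f x) (glue-↑ʳ u s′ (fromℕ (last Γ₂))) ⟩
        s (fromℕ (last Γ₂)) x - δ₁ ≡⟨ cong (_- δ₁) (s-last x) ⟩
        vₖ x - δ₂ - δ₁             ≡⟨ -‿-‿+ (vₖ x) δ₂ δ₁ ⟩
        vₖ x - (δ₁ + δ₂)           ≡⟨ cong (λ d → vₖ x - d) δ≡ ⟨
        vₖ x - δ                   ∎

lemma8 : ∀ {ℓ : Level} (O : LOAG ℓ) {n : ℕ} (t : Transition n) (ts : List (Transition n))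
    → Semantics.Reflects O (t ∷ ts) (Gσ t ts)
lemma8 O t []        = G-reflects O t
lemma8 O t (t′ ∷ ts) = ⊙-reflects O {σ₁ = []} {σ₂ = t′ ∷ ts} (G-reflects O t) (lemma8 O t′ ts)
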